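{- Let $a,n\in\mathbb N$ and let $v_i$ be the prime Jaconian vertex of $J_n(a)$, with $d(v_i)$ its degree in $J_n(a)$. Then $$\epsilon(J_{n+1}(a))=\begin{cases}\epsilon(J_n(a))-i+n & \text{if } d(v_i)=ai,\\ \epsilon(J_n(a))-i+(n+1) & \text{if } d(v_i)<ai.\end{cases}$$
   Context: For $a\in\mathbb N$, the infinite Jaco graph $J_\infty(a)$ is the directed graph with vertex set $\{v_i:i\in\mathbb N\}$ in which every arc has the form $(v_i,v_j)$ with $i<j$, and for $i<j$, $(v_i,v_j)$ is an arc iff $(a+1)i-d^-(v_i)\ge j$, where $d^-(v_i)$ is the in-degree of $v_i$ (determined recursively). For $n\in\mathbb N$, the finite Jaco graph $J_n(a)$ is the subgraph of $J_\infty(a)$ induced on $\{v_1,\dots,v_n\}$. Degrees are in-degree plus out-degree in $J_n(a)$; the prime Jaconian vertex of $J_n(a)$ is the lowest-indexed vertex attaining the maximum degree $\Delta(J_n(a))$. $\epsilon(G)$ denotes the number of arcs of $G$. -}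

module Defs where

open import Data.Nat using (ℕ; zero; suc; _+_; _*_; _∸_; _≤_; _<_; _≤ᵇ_; _<ᵇ_; _≡ᵇ_)
open import Data.Bool using (Bool; true; false; if_then_else_; _∧_; _∨_)
open import Data.Product using (_×_)

count : (ℕ → Bool) → ℕ → ℕ
count p zero    = 0
count p (suc k) = (if p (suc k) then 1 else 0) + count p k

sumTo : (ℕ → ℕ) → ℕ → ℕ
sumTo f zero    = 0
sumTo f (suc k) = f (suc k) + sumTo f k

-- inDegTable a k i = d⁻(v_i) in J_∞(a), correct for 1 ≤ i ≤ k.
-- d⁻(v_{k+1}) = #{ j ∈ {1..k} : (a+1)j − d⁻(v_j) ≥ k+1 }.
inDegTable : ℕ → ℕ → ℕ → ℕ
inDegTable a zero    i = 0
inDegTable a (suc k) i =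
  if i ≡ᵇ suc k
  then count (λ j → suc k ≤ᵇ (suc a * j ∸ inDegTable a k j)) k
  else inDegTable a k i

inDeg : ℕ → ℕ → ℕ
inDeg a i = inDegTable a i i

arc : ℕ → ℕ → ℕ → Bool
arc a i j = (1 ≤ᵇ i) ∧ ((i <ᵇ j) ∧ (j ≤ᵇ (suc a * i ∸ inDeg a i)))

deg : ℕ → ℕ → ℕ → ℕ
deg a n i = count (λ j → arc a i j) n + count (λ j → arc a j i) n

arcs : ℕ → ℕ → ℕ
arcs a n = sumTo (λ i → count (λ j → arc a i j) n) n

IsPrimeJaconian : ℕ → ℕ → ℕ → Set
IsPrimeJaconian a n i =
  (1 ≤ i) × (i ≤ n)
  × (∀ j → 1 ≤ j → j ≤ n → deg a n j ≤ deg a n i)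
  × (∀ j → 1 ≤ j → j < i → deg a n j < deg a n i)

-- Write r(j) = (a+1)j − d⁻(v_j) for the reach of v_j in J_∞(a).  Since d⁻ grows by at most
-- one per step, r is nondecreasing, and r(j) ≥ j as a ≥ 1.  The out-neighbours of v_j in
-- J_n(a) are v_{j+1}, …, v_{min(r(j),n)}, so deg(v_j) = a j when r(j) ≤ n and
-- deg(v_j) = n − j + d⁻(v_j) < a j otherwise.  Passing to J_{n+1}(a) adds exactly the arcs
-- into v_{n+1}, which come from the final segment {v_{m+1}, …, v_n} of vertices with
-- r(j) > n.  For the prime Jaconian vertex v_i: if deg(v_i) = a i then r(i) ≤ n < r(i+1),
-- since otherwise v_{i+1} would have degree a(i+1); if deg(v_i) < a i then
-- r(i−1) ≤ n < r(i), since otherwise v_{i−1} would have degree at least deg(v_i).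
-- So m = i, resp. m = i − 1.
module Submission where

open import Defs
open import Data.Nat using (ℕ; zero; suc; _+_; _*_; _∸_; _⊓_; _≤_; _<_; _≤′_; ≤′-refl; ≤′-step; _≤ᵇ_; _<ᵇ_; z≤n; s≤s; _≤?_; >-nonZero)
open import Data.Nat.Properties
open import Data.Bool using (Bool; true; false; if_then_else_; T; _∧_)
open import Data.Bool.Properties using (T-∧; T-≡)
open import Data.Unit using (tt)
open import Data.Empty using (⊥-elim)
open import Data.Product using (_×_; _,_; proj₁; proj₂)
open import Data.Sum using (inj₁; inj₂)
open import Function.Base using (_∘′_)
open import Function.Bundles using (_⇔_; mk⇔; Equivalence)
open import Relation.Nullary using (¬_; yes; no; contradiction)
open import Relation.Binary.PropositionalEquality
open import Data.Nat.Tactic.RingSolver using (solve-∀)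

open Equivalence using (to; from)

T-injective : ∀ {b c} → (T b ⇔ T c) → b ≡ c
T-injective {false} {false} _ = refl
T-injective {false} {true}  h = ⊥-elim (from h tt)
T-injective {true}  {false} h = ⊥-elim (to h tt)
T-injective {true}  {true}  _ = refl

¬T⇒≡false : ∀ {b} → ¬ T b → b ≡ false
¬T⇒≡false {false} _ = refl
¬T⇒≡false {true}  h = ⊥-elim (h tt)

if-≤1 : ∀ b → (if b then 1 else 0) ≤ 1
if-≤1 true  = ≤-refl
if-≤1 false = z≤n

module _ (p : ℕ → Bool) where

  count-≤ : ∀ n → count p n ≤ n
  count-≤ zero    = z≤n
  count-≤ (suc n) = +-mono-≤ (if-≤1 (p (suc n))) (count-≤ n)

  count-none : ∀ n → (∀ j → 1 ≤ j → j ≤ n → ¬ T (p j)) → count p n ≡ 0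
  count-none zero    _ = refl
  count-none (suc n) h rewrite ¬T⇒≡false (h (suc n) (s≤s z≤n) ≤-refl) =
    count-none n (λ j 1≤j j≤n → h j 1≤j (m≤n⇒m≤1+n j≤n))

  count-truncate : ∀ k n → k ≤ n → (∀ j → k < j → j ≤ n → ¬ T (p j)) → count p n ≡ count p k
  count-truncate k zero    z≤n _ = refl
  count-truncate k (suc n) k≤ h with m≤n⇒m<n∨m≡n k≤
  ... | inj₂ refl = refl
  ... | inj₁ (s≤s k≤n) rewrite ¬T⇒≡false (h (suc n) (s≤s k≤n) ≤-refl) =
    count-truncate k n k≤n (λ j k<j j≤n → h j k<j (m≤n⇒m≤1+n j≤n))

  count-above : ∀ lo n → lo ≤ n → (∀ j → 1 ≤ j → j ≤ n → T (p j) ⇔ lo < j) → count p n + lo ≡ n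
  count-above lo zero    z≤n _ = refl
  count-above lo (suc n) lo≤ h with m≤n⇒m<n∨m≡n lo≤
  ... | inj₂ refl rewrite count-none (suc n) (λ j 1≤j j≤ t → <⇒≱ (to (h j 1≤j j≤) t) j≤) = refl
  ... | inj₁ lo<sn@(s≤s lo≤n) rewrite to T-≡ (from (h (suc n) (s≤s z≤n) ≤-refl) lo<sn) =
    cong suc (count-above lo n lo≤n (λ j 1≤j j≤n → h j 1≤j (m≤n⇒m≤1+n j≤n)))

module _ (p q : ℕ → Bool) where

  count-cong : ∀ n → (∀ j → 1 ≤ j → j ≤ n → p j ≡ q j) → count p n ≡ count q n
  count-cong zero    _ = refl
  count-cong (suc n) h rewrite h (suc n) (s≤s z≤n) ≤-refl =
    cong ((if q (suc n) then 1 else 0) +_) (count-cong n (λ j 1≤j j≤n → h j 1≤j (m≤n⇒m≤1+n j≤n)))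

  count-mono : ∀ n → (∀ j → 1 ≤ j → j ≤ n → T (p j) → T (q j)) → count p n ≤ count q n
  count-mono zero    _ = z≤n
  count-mono (suc n) h with p (suc n) | q (suc n) | h (suc n) (s≤s z≤n) ≤-refl
  ... | true  | true  | _ = s≤s (count-mono n (λ j 1≤j j≤n → h j 1≤j (m≤n⇒m≤1+n j≤n)))
  ... | true  | false | f = ⊥-elim (f tt)
  ... | false | true  | _ = m≤n⇒m≤1+n (count-mono n (λ j 1≤j j≤n → h j 1≤j (m≤n⇒m≤1+n j≤n)))
  ... | false | false | _ = count-mono n (λ j 1≤j j≤n → h j 1≤j (m≤n⇒m≤1+n j≤n))

inDegTable-stable : ∀ a k j → j ≤ k → inDegTable a k j ≡ inDeg a j
inDegTable-stable a zero    .zero z≤n = refl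
inDegTable-stable a (suc k) j j≤ with m≤n⇒m<n∨m≡n j≤
... | inj₂ refl = refl
... | inj₁ (s≤s j≤k) rewrite ¬T⇒≡false (λ t → <-irrefl (≡ᵇ⇒≡ j (suc k) t) (s≤s j≤k)) =
  inDegTable-stable a k j j≤k

reach : ℕ → ℕ → ℕ
reach a j = suc a * j ∸ inDeg a j

inDeg-suc : ∀ a k → inDeg a (suc k) ≡ count (λ j → suc k ≤ᵇ reach a j) k
inDeg-suc a k rewrite to T-≡ (≡⇒≡ᵇ k k refl) =
  count-cong _ _ k (λ j _ j≤k → cong (λ d → suc k ≤ᵇ (suc a * j ∸ d)) (inDegTable-stable a k j j≤k))

inDeg-≤ : ∀ a j → inDeg a j ≤ j
inDeg-≤ a zero    = z≤n
inDeg-≤ a (suc k) rewrite inDeg-suc a k = m≤n⇒m≤1+n (count-≤ _ k)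

inDeg-suc-≤ : ∀ a k → inDeg a (suc k) ≤ suc (inDeg a k)
inDeg-suc-≤ a zero    = inDeg-≤ a 1
inDeg-suc-≤ a (suc k) = begin
  inDeg a (suc (suc k))                                  ≡⟨ inDeg-suc a (suc k) ⟩
  count (λ j → suc (suc k) ≤ᵇ reach a j) (suc k)         ≤⟨ +-mono-≤ (if-≤1 _) (count-mono _ _ k shift) ⟩
  suc (count (λ j → suc k ≤ᵇ reach a j) k)               ≡⟨ cong suc (inDeg-suc a k) ⟨
  suc (inDeg a (suc k))                                  ∎
  where
  open ≤-Reasoning
  shift : ∀ j → 1 ≤ j → j ≤ k → T (suc (suc k) ≤ᵇ reach a j) → T (suc k ≤ᵇ reach a j)
  shift j _ _ t = ≤⇒≤ᵇ (≤-trans (n≤1+n (suc k)) (≤ᵇ⇒≤ (suc (suc k)) (reach a j) t))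

inDeg-lipschitz : ∀ a {i j} → i ≤′ j → inDeg a j + i ≤ inDeg a i + j
inDeg-lipschitz a                 ≤′-refl      = ≤-refl
inDeg-lipschitz a {i} {suc j} (≤′-step i≤′j) = begin
  inDeg a (suc j) + i   ≤⟨ +-monoˡ-≤ i (inDeg-suc-≤ a j) ⟩
  suc (inDeg a j + i)   ≤⟨ s≤s (inDeg-lipschitz a i≤′j) ⟩
  suc (inDeg a i + j)   ≡⟨ +-suc (inDeg a i) j ⟨
  inDeg a i + suc j     ∎
  where open ≤-Reasoning

reach+inDeg : ∀ a j → reach a j + inDeg a j ≡ j + a * j
reach+inDeg a j = m∸n+n≡m (≤-trans (inDeg-≤ a j) (m≤m+n j (a * j)))

reach-zero : ∀ a → reach a 0 ≡ 0
reach-zero a = *-zeroʳ (suc a)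

reach-mono : ∀ a {i j} → i ≤ j → reach a i ≤ reach a j
reach-mono a {i} {j} i≤j = +-cancelʳ-≤ (inDeg a i + j) (reach a i) (reach a j) (begin
  reach a i + (inDeg a i + j)   ≡⟨ +-assoc (reach a i) (inDeg a i) j ⟨
  reach a i + inDeg a i + j     ≡⟨ cong (_+ j) (reach+inDeg a i) ⟩
  i + a * i + j                 ≡⟨ regroup i a j ⟩
  j + a * i + i                 ≤⟨ +-monoˡ-≤ i (+-monoʳ-≤ j (*-monoʳ-≤ a i≤j)) ⟩
  j + a * j + i                 ≡⟨ cong (_+ i) (reach+inDeg a j) ⟨
  reach a j + inDeg a j + i     ≡⟨ +-assoc (reach a j) (inDeg a j) i ⟩
  reach a j + (inDeg a j + i)   ≤⟨ +-monoʳ-≤ (reach a j) (inDeg-lipschitz a (≤⇒≤′ i≤j)) ⟩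
  reach a j + (inDeg a i + j)   ∎)
  where
  open ≤-Reasoning
  regroup : ∀ i a j → i + a * i + j ≡ j + a * i + i
  regroup = solve-∀

≤-reach : ∀ a j → 1 ≤ a → j ≤ reach a j
≤-reach a j 1≤a = +-cancelʳ-≤ (inDeg a j) j (reach a j) (begin
  j + inDeg a j          ≤⟨ +-monoʳ-≤ j (≤-trans (inDeg-≤ a j) (m≤n*m j a ⦃ >-nonZero 1≤a ⦄)) ⟩
  j + a * j              ≡⟨ reach+inDeg a j ⟨
  reach a j + inDeg a j  ∎)
  where open ≤-Reasoning

module _ (a : ℕ) {i j : ℕ} where

  private
    arc-split : T (arc a i j) ⇔ (T (1 ≤ᵇ i) × T ((i <ᵇ j) ∧ (j ≤ᵇ reach a i)))
    arc-split = T-∧ {1 ≤ᵇ i}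

    arc-split′ : T ((i <ᵇ j) ∧ (j ≤ᵇ reach a i)) ⇔ (T (i <ᵇ j) × T (j ≤ᵇ reach a i))
    arc-split′ = T-∧ {i <ᵇ j}

  arc⇒< : T (arc a i j) → i < j
  arc⇒< t = <ᵇ⇒< i j (proj₁ (to arc-split′ (proj₂ (to arc-split t))))

  arc⇒≤reach : T (arc a i j) → j ≤ reach a i
  arc⇒≤reach t = ≤ᵇ⇒≤ j (reach a i) (proj₂ (to arc-split′ (proj₂ (to arc-split t))))

  arc-intro : 1 ≤ i → i < j → j ≤ reach a i → T (arc a i j)
  arc-intro 1≤i i<j j≤r = from arc-split (≤⇒≤ᵇ 1≤i , from arc-split′ (<⇒<ᵇ i<j , ≤⇒≤ᵇ j≤r))

in-count : ∀ a n k → suc k ≤ n → count (λ j → arc a j (suc k)) n ≡ inDeg a (suc k)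
in-count a n k sk≤n = begin
  count (λ j → arc a j (suc k)) n   ≡⟨ count-truncate _ k n (≤-trans (n≤1+n k) sk≤n) (λ j k<j _ t → <⇒≱ (arc⇒< a t) k<j) ⟩
  count (λ j → arc a j (suc k)) k   ≡⟨ count-cong _ _ k (λ j 1≤j j≤k → T-injective (mk⇔ (≤⇒≤ᵇ ∘′ arc⇒≤reach a {j}) (arc-into 1≤j j≤k))) ⟩
  count (λ j → suc k ≤ᵇ reach a j) k ≡⟨ inDeg-suc a k ⟨
  inDeg a (suc k)                   ∎
  where
  open ≡-Reasoning
  arc-into : ∀ {j} → 1 ≤ j → j ≤ k → T (suc k ≤ᵇ reach a j) → T (arc a j (suc k))
  arc-into {j} 1≤j j≤k t = arc-intro a 1≤j (s≤s j≤k) (≤ᵇ⇒≤ (suc k) (reach a j) t)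

out-count : ∀ a n i → 1 ≤ a → 1 ≤ i → i ≤ n → count (λ j → arc a i j) n + i ≡ reach a i ⊓ n
out-count a n i 1≤a 1≤i i≤n = begin
  count (λ j → arc a i j) n + i     ≡⟨ cong (_+ i) (count-truncate _ m n (m⊓n≤n (reach a i) n) beyond) ⟩
  count (λ j → arc a i j) m + i     ≡⟨ count-above _ i m (⊓-glb (≤-reach a i 1≤a) i≤n) arc⇔< ⟩
  m                                 ∎
  where
  open ≡-Reasoning
  m = reach a i ⊓ n
  beyond : ∀ j → m < j → j ≤ n → ¬ T (arc a i j)
  beyond j m<j j≤n t = <⇒≱ m<j (⊓-glb (arc⇒≤reach a {i} t) j≤n)
  arc⇔< : ∀ j → 1 ≤ j → j ≤ m → T (arc a i j) ⇔ i < j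
  arc⇔< j _ j≤m = mk⇔ (arc⇒< a {i} {j}) (λ i<j → arc-intro a 1≤i i<j (≤-trans j≤m (m⊓n≤m (reach a i) n)))

module _ (a n k : ℕ) (1≤a : 1 ≤ a) (sk≤n : suc k ≤ n) where

  deg+index : deg a n (suc k) + suc k ≡ reach a (suc k) ⊓ n + inDeg a (suc k)
  deg+index = begin
    out + in′ + suc k    ≡⟨ swap out in′ (suc k) ⟩
    out + suc k + in′    ≡⟨ cong₂ _+_ (out-count a n (suc k) 1≤a (s≤s z≤n) sk≤n) (in-count a n k sk≤n) ⟩
    reach a (suc k) ⊓ n + inDeg a (suc k)   ∎
    where
    open ≡-Reasoning
    out = count (λ j → arc a (suc k) j) n
    in′ = count (λ j → arc a j (suc k)) n
    swap : ∀ x y z → x + y + z ≡ x + z + y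
    swap = solve-∀

  deg-reached : reach a (suc k) ≤ n → deg a n (suc k) ≡ a * suc k
  deg-reached r≤n = +-cancelʳ-≡ (suc k) _ _ (begin
    deg a n (suc k) + suc k                ≡⟨ deg+index ⟩
    reach a (suc k) ⊓ n + inDeg a (suc k)  ≡⟨ cong (_+ inDeg a (suc k)) (m≤n⇒m⊓n≡m r≤n) ⟩
    reach a (suc k) + inDeg a (suc k)      ≡⟨ reach+inDeg a (suc k) ⟩
    suc k + a * suc k                      ≡⟨ +-comm (suc k) _ ⟩
    a * suc k + suc k                      ∎)
    where open ≡-Reasoning

  deg-unreached : n ≤ reach a (suc k) → deg a n (suc k) + suc k ≡ inDeg a (suc k) + n
  deg-unreached n≤r = begin
    deg a n (suc k) + suc k                ≡⟨ deg+index ⟩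
    reach a (suc k) ⊓ n + inDeg a (suc k)  ≡⟨ cong (_+ inDeg a (suc k)) (m≥n⇒m⊓n≡n n≤r) ⟩
    n + inDeg a (suc k)                    ≡⟨ +-comm n _ ⟩
    inDeg a (suc k) + n                    ∎
    where open ≡-Reasoning

  deg-unreached-< : n < reach a (suc k) → deg a n (suc k) < a * suc k
  deg-unreached-< n<r = +-cancelʳ-< (suc k) _ _ (begin-strict
    deg a n (suc k) + suc k                ≡⟨ deg-unreached (<⇒≤ n<r) ⟩
    inDeg a (suc k) + n                    <⟨ +-monoʳ-< (inDeg a (suc k)) n<r ⟩
    inDeg a (suc k) + reach a (suc k)      ≡⟨ +-comm (inDeg a (suc k)) _ ⟩
    reach a (suc k) + inDeg a (suc k)      ≡⟨ reach+inDeg a (suc k) ⟩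
    suc k + a * suc k                      ≡⟨ +-comm (suc k) _ ⟩
    a * suc k + suc k                      ∎)
    where open ≤-Reasoning

sumTo-+ : ∀ f g k → sumTo (λ i → f i + g i) k ≡ sumTo f k + sumTo g k
sumTo-+ f g zero    = refl
sumTo-+ f g (suc k) = trans (cong (f (suc k) + g (suc k) +_) (sumTo-+ f g k))
  (+-+-comm (f (suc k)) (g (suc k)) (sumTo f k) (sumTo g k))
  where
  +-+-comm : ∀ w x y z → w + x + (y + z) ≡ w + y + (x + z)
  +-+-comm = solve-∀

count≡sumTo : ∀ p k → count p k ≡ sumTo (λ i → if p i then 1 else 0) k
count≡sumTo p zero    = refl
count≡sumTo p (suc k) = cong ((if p (suc k) then 1 else 0) +_) (count≡sumTo p k)

arcs-suc : ∀ a n → arcs a (suc n) ≡ arcs a n + count (λ j → arc a j (suc n)) n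
arcs-suc a n = begin
  arcs a (suc n)                                     ≡⟨ cong (_+ sumTo row n) no-arcs-out ⟩
  sumTo (λ i → column i + count (arc a i) n) n       ≡⟨ sumTo-+ column (λ i → count (arc a i) n) n ⟩
  sumTo column n + arcs a n                          ≡⟨ cong (_+ arcs a n) (count≡sumTo (λ i → arc a i (suc n)) n) ⟨
  count (λ j → arc a j (suc n)) n + arcs a n         ≡⟨ +-comm _ (arcs a n) ⟩
  arcs a n + count (λ j → arc a j (suc n)) n         ∎
  where
  open ≡-Reasoning
  row : ℕ → ℕ
  row i = count (arc a i) (suc n)
  column : ℕ → ℕ
  column i = if arc a i (suc n) then 1 else 0
  no-arcs-out : row (suc n) ≡ 0
  no-arcs-out = count-none _ (suc n) (λ j _ j≤sn t → <⇒≱ (arc⇒< a {suc n} {j} t) j≤sn)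

arcs-extend : ∀ a n m → m ≤ n → reach a m ≤ n → n < reach a (suc m) → arcs a (n + 1) + m ≡ arcs a n + n
arcs-extend a n m m≤n rm≤n n<rsm = begin
  arcs a (n + 1) + m          ≡⟨ cong (λ x → arcs a x + m) (+-comm n 1) ⟩
  arcs a (suc n) + m          ≡⟨ cong (_+ m) (arcs-suc a n) ⟩
  arcs a n + into-new + m     ≡⟨ +-assoc (arcs a n) into-new m ⟩
  arcs a n + (into-new + m)   ≡⟨ cong (arcs a n +_) (count-above _ m n m≤n arc⇔above) ⟩
  arcs a n + n                ∎
  where
  open ≡-Reasoning
  into-new = count (λ j → arc a j (suc n)) n
  arc⇔above : ∀ j → 1 ≤ j → j ≤ n → T (arc a j (suc n)) ⇔ m < j
  arc⇔above j 1≤j j≤n = mk⇔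
    (λ t → ≰⇒> (λ j≤m → <⇒≱ (arc⇒≤reach a {j} t) (≤-trans (reach-mono a j≤m) rm≤n)))
    (λ m<j → arc-intro a 1≤j (s≤s j≤n) (≤-trans n<rsm (reach-mono a m<j)))

reached-boundary : ∀ a n k → 1 ≤ a → IsPrimeJaconian a n (suc k) → reach a (suc k) ≤ n →
  n < reach a (suc (suc k))
reached-boundary a n k 1≤a (_ , sk≤n , maximal , _) r≤n = ≰⇒> λ r′≤n →
  let ssk≤n = ≤-trans (≤-reach a (suc (suc k)) 1≤a) r′≤n in
  <⇒≱ (*-monoʳ-< a ⦃ >-nonZero 1≤a ⦄ ≤-refl)
      (subst₂ _≤_ (deg-reached a n (suc k) 1≤a ssk≤n r′≤n) (deg-reached a n k 1≤a sk≤n r≤n)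
        (maximal (suc (suc k)) (s≤s z≤n) ssk≤n))

unreached-boundary : ∀ a n k → 1 ≤ a → IsPrimeJaconian a n (suc k) → n < reach a (suc k) →
  reach a k ≤ n
unreached-boundary a n zero    _   _ _ = subst (_≤ n) (sym (reach-zero a)) z≤n
unreached-boundary a n (suc k) 1≤a (_ , ssk≤n , _ , lowest) n<r = ≮⇒≥ λ n<r′ →
  <⇒≱ (lowest (suc k) (s≤s z≤n) ≤-refl) (+-cancelʳ-≤ (suc (suc k)) _ _ (begin
    deg a n (suc (suc k)) + suc (suc k)   ≡⟨ deg-unreached a n (suc k) 1≤a ssk≤n (<⇒≤ n<r) ⟩
    inDeg a (suc (suc k)) + n             ≤⟨ +-monoˡ-≤ n (inDeg-suc-≤ a (suc k)) ⟩
    suc (inDeg a (suc k) + n)             ≡⟨ cong suc (deg-unreached a n k 1≤a (≤-trans (n≤1+n _) ssk≤n) (<⇒≤ n<r′)) ⟨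
    suc (deg a n (suc k) + suc k)         ≡⟨ +-suc (deg a n (suc k)) (suc k) ⟨
    deg a n (suc k) + suc (suc k)         ∎))
  where open ≤-Reasoning

corollary3p3 : (a n i : ℕ) → 1 ≤ a → 1 ≤ n → IsPrimeJaconian a n i →
    ((deg a n i ≡ a * i → arcs a (n + 1) + i ≡ arcs a n + n)
    × (deg a n i < a * i → arcs a (n + 1) + i ≡ arcs a n + (n + 1)))
corollary3p3 a n zero _ _ (() , _)
corollary3p3 a n (suc k) 1≤a _ jaconian@(_ , sk≤n , _) with reach a (suc k) ≤? n
... | yes r≤n =
  (λ _ → arcs-extend a n (suc k) sk≤n r≤n (reached-boundary a n k 1≤a jaconian r≤n)) ,
  (λ deg< → contradiction (deg-reached a n k 1≤a sk≤n r≤n) (<⇒≢ deg<))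
... | no r≰n = let n<r = ≰⇒> r≰n in
  (λ deg≡ → contradiction deg≡ (<⇒≢ (deg-unreached-< a n k 1≤a sk≤n n<r))) ,
  (λ _ → begin
    arcs a (n + 1) + suc k   ≡⟨ +-suc (arcs a (n + 1)) k ⟩
    suc (arcs a (n + 1) + k) ≡⟨ cong suc (arcs-extend a n k (≤-trans (n≤1+n k) sk≤n)
                                  (unreached-boundary a n k 1≤a jaconian n<r) n<r) ⟩
    suc (arcs a n + n)       ≡⟨ +-suc (arcs a n) n ⟨
    arcs a n + suc n         ≡⟨ cong (arcs a n +_) (+-comm 1 n) ⟩
    arcs a n + (n + 1)       ∎)
  where open ≡-Reasoning
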